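{- Let $G$ be a planar ribbon graph such that both $G$ and its planar dual $G^*$ are loopless, let $u$ be a vertex of $G$, and let $e_0,e_1,\dots,e_k$ be edges at $u$, all directed outward from $u$, such that $e_{i}$ is the edge immediately following $e_{i-1}$ in the cyclic order at $u$ for $i=1,\dots,k$. For $i=0,\dots,k$ let $r_i$ be the face of $G$ (equivalently vertex of $G^*$) lying to the right of $e_i$, i.e. the face between $e_i$ and the edge following $e_i$ in the cyclic order at $u$. Then \[\phi(\angle^u(e_0,e_k))=[r_0-r_k]\in\mathrm{Jac}(G^*).\]
   Context: $\mathrm{Jac}(G)=\mathrm{Div}^0(G)/\!\sim$ is the sandpile group: degree-zero integer combinations of vertices modulo the equivalence generated by lending moves (a lending move at $v$ subtracts $\deg(v)$ from the coefficient of $v$ and adds the number of edges between $v$ and $w$ to the coefficient of each $w\ne v$). For a directed edge $e$, $\partial e=[\mathrm{head}(e)-\mathrm{tail}(e)]$. A ribbon graph has a cyclic ordering of edges at each vertex; $G$ planar means these come from a plane embedding, the corresponding orientation of the plane being called clockwise. Angle: for outward-directed edges $e,e'$ at $u$, if starting from $e=e_0$ the edges in the cyclic order at $u$ up to $e'$ are $e_0,e_1,\dots,e_k=e'$ (all directed outward from $u$), then $\angle^u(e,e')=\sum_{i=1}^k\partial e_i\in\mathrm{Jac}(G)$ (it includes $e'$ but not $e$). Duality: $G^*$ has a vertex for each face of $G$ and an edge $e^*$ crossing each edge $e$. Fixing an orientation of each edge $e$ of $G$ with tail $v$, the face "before $e$" is the one between $e$ and the preceding edge in the cyclic order at $v$,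 and the face "after $e$" is the one between $e$ and the following edge; $e^*$ is oriented with head the face before $e$ and tail the face after $e$. The isomorphism $\phi\colon\mathrm{Jac}(G)\to\mathrm{Jac}(G^*)$ is induced by $e\mapsto e^*$ on $\mathbb{Z}E/(\text{cycle space}+\text{cut space})\cong\mathrm{Jac}(G)$ (the latter via $e\mapsto\partial e$), so that $\phi(\partial_G e)=\partial_{G^*}(e^*)$ for every oriented edge $e$ of $G$. -}

module Defs where

open import Data.Nat using (ℕ; zero; suc; _<_)
open import Data.Fin using (Fin; zero; suc)
open import Data.Fin.Properties using (_≟_)
open import Data.Fin.Permutation using (Permutation′; _⟨$⟩ʳ_)
open import Data.Integer using (ℤ; _+_; _-_; _*_; 0ℤ; 1ℤ)
open import Data.Product using (Σ; ∃; _×_; _,_)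
open import Relation.Binary.PropositionalEquality using (_≡_; _≢_)
open import Relation.Nullary using (yes; no)

iter : ∀ {A : Set} → (A → A) → ℕ → A → A
iter f zero    x = x
iter f (suc k) x = f (iter f k x)

sumFin : (m : ℕ) → (Fin m → ℤ) → ℤ
sumFin zero    f = 0ℤ
sumFin (suc m) f = f zero + sumFin m (λ i → f (suc i))

Div : ℕ → Set
Div m = Fin m → ℤ

deg : ∀ {m} → Div m → ℤ
deg {m} D = sumFin m D

zeroᴰ : ∀ {m} → Div m
zeroᴰ _ = 0ℤ

_+ᴰ_ : ∀ {m} → Div m → Div m → Div m
(D +ᴰ D′) w = D w + D′ w

_-ᴰ_ : ∀ {m} → Div m → Div m → Div m
(D -ᴰ D′) w = D w - D′ w

δ : ∀ {m} → Fin m → Div m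
δ v w with v ≟ w
... | yes _ = 1ℤ
... | no  _ = 0ℤ

-- A multigraph presented by darts (half-edges): n darts, m vertices,
-- each dart d is the edge directed outward from tl d, with head hd d.
-- Each undirected edge corresponds to two darts (one from each end).

-- The lending move at v: for loopless graphs it subtracts deg(v) from v
-- and adds (# edges between v and w) to each w ≠ v.
lend : ∀ {m n} → (tl hd : Fin n → Fin m) → Fin m → Div m
lend {m} {n} tl hd v w =
  sumFin n (λ d → indic (tl d) (δ (hd d) w - δ v w))
  where
  indic : Fin m → ℤ → ℤ
  indic x z with x ≟ v
  ... | yes _ = z
  ... | no  _ = 0ℤ

LinEq : ∀ {m n} → (tl hd : Fin n → Fin m) → Div m → Div m → Set
LinEq {m} tl hd D D′ =
  Σ (Fin m → ℤ) λ f → ∀ w → D w - D′ w ≡ sumFin m (λ v → f v * lend tl hd v w)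

-- Darts = Fin n.  α = edge involution (dart d ↦ the same edge directed
-- the other way), σ = successor in the (clockwise) cyclic order at the
-- tail vertex.  Vertices = σ-orbits, labelled by vert : Fin n → Fin nv.
-- Faces: face d is the face between d and σ d at the tail of d (the face
-- to the right of d); faces are the orbits of d ↦ α (σ d), labelled by
-- face : Fin n → Fin nf.

record RibbonGraph : Set where
  field
    n nv nf : ℕ
    σ α     : Permutation′ n
    α-invol : ∀ d → α ⟨$⟩ʳ (α ⟨$⟩ʳ d) ≡ d
    α-free  : ∀ d → α ⟨$⟩ʳ d ≢ d
    vert    : Fin n → Fin nv
    vert-orbit   : ∀ d d′ → vert d ≡ vert d′ → ∃ λ k → iter (σ ⟨$⟩ʳ_) k d ≡ d′
    orbit-vert   : ∀ d k → vert (iter (σ ⟨$⟩ʳ_) k d) ≡ vert d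
    vert-surj    : ∀ v → ∃ λ d → vert d ≡ v
    face    : Fin n → Fin nf
    face-orbit   : ∀ d d′ → face d ≡ face d′ → ∃ λ k → iter (λ x → α ⟨$⟩ʳ (σ ⟨$⟩ʳ x)) k d ≡ d′
    orbit-face   : ∀ d k → face (iter (λ x → α ⟨$⟩ʳ (σ ⟨$⟩ʳ x)) k d) ≡ face d
    face-surj    : ∀ f → ∃ λ d → face d ≡ f

module _ (G : RibbonGraph) where
  open RibbonGraph G

  σ· α· : Fin n → Fin n
  σ· d = σ ⟨$⟩ʳ d
  α· d = α ⟨$⟩ʳ d

  data Reach (d : Fin n) : Fin n → Set where
    here   : Reach d d
    stepσ  : ∀ {d′} → Reach d d′ → Reach d (σ· d′)
    stepα  : ∀ {d′} → Reach d d′ → Reach d (α· d′)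

  Connected : Set
  Connected = ∀ d d′ → Reach d d′

  -- genus 0 (Euler's formula V - E + F = 2 with E = n/2), which for a
  -- connected ribbon graph says the rotation system comes from a plane
  -- embedding
  Planar : Set
  Planar = 2 Data.Nat.* (nv Data.Nat.+ nf) ≡ n Data.Nat.+ 4

  Loopless : Set
  Loopless = ∀ d → vert (α· d) ≢ vert d

  DualLoopless : Set
  DualLoopless = ∀ d → face (α· d) ≢ face d

  _~G_ : Div nv → Div nv → Set
  _~G_ = LinEq vert (λ d → vert (α· d))

  -- G* as a dart graph: the dual of dart d has tail the face after d
  -- (face d, to the right of d) and head the face before d
  -- (face (σ⁻¹ d) = face (α d), to the left of d)
  _~*_ : Div nf → Div nf → Set
  _~*_ = LinEq face (λ d → face (α· d))

  ∂G : Fin n → Div nv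
  ∂G d = δ (vert (α· d)) -ᴰ δ (vert d)

  ∂* : Fin n → Div nf
  ∂* d = δ (face (α· d)) -ᴰ δ (face d)

  -- φ : Jac(G) → Jac(G*), represented on degree-zero divisors: a map
  -- respecting linear equivalence, additive modulo linear equivalence,
  -- and sending ∂ e to ∂ e* (this determines φ on Jac(G) uniquely,
  -- since the ∂ e generate Div⁰ for connected G)
  record IsDualIso (φ : Div nv → Div nf) : Set where
    field
      resp  : ∀ D D′ → deg D ≡ 0ℤ → deg D′ ≡ 0ℤ → D ~G D′ → φ D ~* φ D′
      add   : ∀ D D′ → deg D ≡ 0ℤ → deg D′ ≡ 0ℤ → φ (D +ᴰ D′) ~* (φ D +ᴰ φ D′)
      edge  : ∀ d → φ (∂G d) ~* ∂* d

  angleSum : Fin n → ℕ → Div nv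
  angleSum e zero    = zeroᴰ
  angleSum e (suc m) = angleSum e m +ᴰ ∂G (iter σ· (suc m) e)

  Steps : Fin n → Fin n → ℕ → Set
  Steps e e′ m = (iter σ· m e ≡ e′) × (∀ j → j < m → iter σ· j e ≢ e′)

  Angle : Fin n → Fin n → Div nv → Set
  Angle e e′ A = Σ ℕ λ m → Steps e e′ m × (A ≡ angleSum e m)

module Submission where

-- Write e_j = σ^j e₀ for the darts at u and r_j = face e_j for
-- the face to the right of e_j.  Consecutive darts e_j, e_{j+1} share a face:
-- the face to the LEFT of e_{j+1} (the head of e_{j+1}*) is face (α (σ e_j)),
-- which lies on the face orbit of e_j, hence equals r_j.  So
--     ∂ (e_{j+1}*) = [r_j] - [r_{j+1}],
-- and the angle Σ_{i=1}^{m} ∂ e_i is sent by φ to a telescoping sum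
-- Σ_{i=1}^{m} ([r_{i-1}] - [r_i]) = [r_0] - [r_m].  Only the additivity of φ
-- on degree-zero divisors and φ(∂ e) ~ ∂ e* are needed, and additivity
-- applies because every partial angle sum has degree zero.
--
-- Connectedness, planarity
-- and looplessness are what make φ exist (an isomorphism of Jacobians); the
-- computation itself only uses the listed properties of φ.

open import Defs
open import Data.Nat using (ℕ; zero; suc)
open import Data.Fin using (Fin; zero; suc)
open import Data.Fin.Properties using (_≟_)
open import Data.Integer using (ℤ; _+_; _-_; _*_; -_; 0ℤ; 1ℤ)
open import Data.Integer.Properties
  using (+-identityˡ; *-distribʳ-+; neg-distribˡ-*)
open import Data.Integer.Solver using (module +-*-Solver)
open import Data.Product using (_,_)
open import Relation.Binary.PropositionalEquality
  using (_≡_; refl; sym; trans; cong; cong₂; subst; module ≡-Reasoning)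
open import Relation.Nullary using (yes; no)
open +-*-Solver using (solve; _:+_; _:-_; :-_; _:=_; con)

sumFin-cong : ∀ m {f g : Fin m → ℤ} → (∀ i → f i ≡ g i) → sumFin m f ≡ sumFin m g
sumFin-cong zero    f≗g = refl
sumFin-cong (suc m) f≗g = cong₂ _+_ (f≗g zero) (sumFin-cong m (λ i → f≗g (suc i)))

sumFin-zero : ∀ m → sumFin m (λ _ → 0ℤ) ≡ 0ℤ
sumFin-zero zero    = refl
sumFin-zero (suc m) = trans (+-identityˡ _) (sumFin-zero m)

sumFin-+ : ∀ m (f g : Fin m → ℤ) → sumFin m (λ i → f i + g i) ≡ sumFin m f + sumFin m g
sumFin-+ zero    f g = refl
sumFin-+ (suc m) f g = trans (cong (f zero + g zero +_) (sumFin-+ m _ _))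
  (solve 4 (λ a b c d → (a :+ b) :+ (c :+ d) := (a :+ c) :+ (b :+ d)) refl
     (f zero) (g zero) _ _)

sumFin-neg : ∀ m (f : Fin m → ℤ) → sumFin m (λ i → - f i) ≡ - sumFin m f
sumFin-neg zero    f = refl
sumFin-neg (suc m) f = trans (cong (- f zero +_) (sumFin-neg m _))
  (solve 2 (λ a b → (:- a) :+ (:- b) := :- (a :+ b)) refl (f zero) _)

sumFin-- : ∀ m (f g : Fin m → ℤ) → sumFin m (λ i → f i - g i) ≡ sumFin m f - sumFin m g
sumFin-- m f g = trans (sumFin-+ m f (λ i → - g i)) (cong (sumFin m f +_) (sumFin-neg m g))

δ-suc : ∀ {m} (v w : Fin m) → δ (suc v) (suc w) ≡ δ v w
δ-suc v w with v ≟ w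
... | yes _ = refl
... | no  _ = refl

deg-δ : ∀ {m} (v : Fin m) → deg (δ v) ≡ 1ℤ
deg-δ {suc m} zero    = cong (1ℤ +_) (sumFin-zero m)
deg-δ {suc m} (suc v) =
  trans (+-identityˡ _) (trans (sumFin-cong m (δ-suc v)) (deg-δ v))

deg-δ-δ : ∀ {m} (a b : Fin m) → deg (δ a -ᴰ δ b) ≡ 0ℤ
deg-δ-δ {m} a b = trans (sumFin-- m (δ a) (δ b)) (cong₂ _-_ (deg-δ a) (deg-δ b))

deg-+ : ∀ {m} (D D′ : Div m) → deg (D +ᴰ D′) ≡ deg D + deg D′
deg-+ {m} D D′ = sumFin-+ m D D′

cancel : ∀ {m} (D : Div m) w → (D -ᴰ D) w ≡ zeroᴰ w
cancel D w = solve 1 (λ a → a :- a := con 0ℤ) refl (D w)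

telescope : ∀ {m} (A B C : Div m) w → ((A -ᴰ B) +ᴰ (B -ᴰ C)) w ≡ (A -ᴰ C) w
telescope A B C w =
  solve 3 (λ a b c → (a :- b) :+ (b :- c) := a :- c) refl (A w) (B w) (C w)

module LinearEquivalence {m n : ℕ} (tl hd : Fin n → Fin m) where

  infix 4 _~_
  _~_ : Div m → Div m → Set
  _~_ = LinEq tl hd

  lending : (Fin m → ℤ) → Div m
  lending f w = sumFin m (λ v → f v * lend tl hd v w)

  lending-+ : ∀ f g w → lending (λ v → f v + g v) w ≡ lending f w + lending g w
  lending-+ f g w =
    trans (sumFin-cong m (λ v → *-distribʳ-+ (lend tl hd v w) (f v) (g v)))
          (sumFin-+ m _ _)

  lending-neg : ∀ f w → lending (λ v → - f v) w ≡ - lending f w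
  lending-neg f w =
    trans (sumFin-cong m (λ v → sym (neg-distribˡ-* (f v) (lend tl hd v w))))
          (sumFin-neg m _)

  ~-reflexive : ∀ {D D′} → (∀ w → D w ≡ D′ w) → D ~ D′
  ~-reflexive {D} {D′} D≗D′ = (λ _ → 0ℤ) , λ w → begin
    D w - D′ w   ≡⟨ cong (λ z → D w - z) (sym (D≗D′ w)) ⟩
    D w - D w    ≡⟨ cancel D w ⟩
    0ℤ           ≡⟨ sym (sumFin-zero m) ⟩
    lending (λ _ → 0ℤ) w ∎
    where open ≡-Reasoning

  ~-refl : ∀ {D} → D ~ D
  ~-refl {D} = ~-reflexive {D} {D} (λ _ → refl)

  ~-trans : ∀ {D D′ D″} → D ~ D′ → D′ ~ D″ → D ~ D″
  ~-trans {D} {D′} {D″} (f , p) (g , q) = (λ v → f v + g v) , λ w → begin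
    D w - D″ w                   ≡⟨ sym (telescope D D′ D″ w) ⟩
    (D w - D′ w) + (D′ w - D″ w) ≡⟨ cong₂ _+_ (p w) (q w) ⟩
    lending f w + lending g w    ≡⟨ sym (lending-+ f g w) ⟩
    lending (λ v → f v + g v) w  ∎
    where open ≡-Reasoning

  ~-cong-+ : ∀ {A B C D} → A ~ B → C ~ D → (A +ᴰ C) ~ (B +ᴰ D)
  ~-cong-+ {A} {B} {C} {D} (f , p) (g , q) = (λ v → f v + g v) , λ w → begin
    (A w + C w) - (B w + D w)   ≡⟨ solve 4 (λ a b c d → (a :+ c) :- (b :+ d) := (a :- b) :+ (c :- d))
                                     refl (A w) (B w) (C w) (D w) ⟩
    (A w - B w) + (C w - D w)   ≡⟨ cong₂ _+_ (p w) (q w) ⟩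
    lending f w + lending g w   ≡⟨ sym (lending-+ f g w) ⟩
    lending (λ v → f v + g v) w ∎
    where open ≡-Reasoning

  ~-zero-of-double : ∀ {D} → D ~ (D +ᴰ D) → D ~ zeroᴰ
  ~-zero-of-double {D} (f , p) = (λ v → - f v) , λ w → begin
    D w - 0ℤ                    ≡⟨ solve 1 (λ a → a :- con 0ℤ := :- (a :- (a :+ a))) refl (D w) ⟩
    - (D w - (D w + D w))       ≡⟨ cong -_ (p w) ⟩
    - lending f w               ≡⟨ sym (lending-neg f w) ⟩
    lending (λ v → - f v) w     ∎
    where open ≡-Reasoning

  module ~-Reasoning where
    open import Relation.Binary.Reasoning.Base.Single _~_
      (λ {D} → ~-refl {D}) (λ {D D′ D″} → ~-trans {D} {D′} {D″}) public

module Duality (G : RibbonGraph) where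
  open RibbonGraph G

  rot : Fin n → ℕ → Fin n
  rot e j = iter (σ· G) j e

  -- The face to the left of σ x is the face to the right of x (they lie on
  -- one face orbit), so the dual of σ x runs from face (σ x) to face x.
  ∂*-σ : ∀ x w → ∂* G (σ· G x) w ≡ (δ (face x) -ᴰ δ (face (σ· G x))) w
  ∂*-σ x w = cong (λ f → δ f w - δ (face (σ· G x)) w) (orbit-face x 1)

  deg-angleSum : ∀ e j → deg (angleSum G e j) ≡ 0ℤ
  deg-angleSum e zero    = sumFin-zero nv
  deg-angleSum e (suc j) = begin
    deg (angleSum G e j +ᴰ ∂G G d)           ≡⟨ deg-+ (angleSum G e j) (∂G G d) ⟩
    deg (angleSum G e j) + deg (∂G G d)     ≡⟨ cong₂ _+_ (deg-angleSum e j)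
                                                  (deg-δ-δ (vert (α· G d)) (vert d)) ⟩
    0ℤ                                      ∎
    where
    open ≡-Reasoning
    d = rot e (suc j)

  module _ (φ : Div nv → Div nf) (iso : IsDualIso G φ) where
    open IsDualIso iso
    open LinearEquivalence face (λ d → face (α· G d))

    φ-zero : φ zeroᴰ ~ zeroᴰ
    φ-zero = ~-zero-of-double {φ zeroᴰ} (add zeroᴰ zeroᴰ (sumFin-zero nv) (sumFin-zero nv))

    φ-angleSum : ∀ e j → φ (angleSum G e j) ~ (δ (face e) -ᴰ δ (face (rot e j)))
    φ-angleSum e zero = begin
      φ zeroᴰ                         ∼⟨ φ-zero ⟩
      zeroᴰ                           ∼⟨ ~-reflexive {zeroᴰ} {δ r₀ -ᴰ δ r₀} (λ w → sym (cancel (δ r₀) w)) ⟩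
      δ r₀ -ᴰ δ r₀                    ∎
      where
      open ~-Reasoning
      r₀ = face e
    φ-angleSum e (suc j) = begin
      φ (A +ᴰ ∂G G d)                           ∼⟨ add A (∂G G d) (deg-angleSum e j)
                                                      (deg-δ-δ (vert (α· G d)) (vert d)) ⟩
      φ A +ᴰ φ (∂G G d)                         ∼⟨ ~-cong-+ {φ A} {δ r₀ -ᴰ δ rⱼ} {φ (∂G G d)} {∂* G d}
                                                      (φ-angleSum e j) (edge d) ⟩
      (δ r₀ -ᴰ δ rⱼ) +ᴰ ∂* G d                  ∼⟨ ~-reflexive {(δ r₀ -ᴰ δ rⱼ) +ᴰ ∂* G d} {δ r₀ -ᴰ δ rⱼ₊₁}
                                                      (λ w → trans (cong ((δ r₀ -ᴰ δ rⱼ) w +_) (∂*-σ x w))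
                                                                   (telescope (δ r₀) (δ rⱼ) (δ rⱼ₊₁) w)) ⟩
      δ r₀ -ᴰ δ rⱼ₊₁                            ∎
      where
      open ~-Reasoning
      A = angleSum G e j
      x = rot e j
      d = σ· G x
      r₀ = face e
      rⱼ = face x
      rⱼ₊₁ = face d

lemma3p2 : (G : RibbonGraph) → Connected G → Planar G → Loopless G → DualLoopless G →
    (φ : Div (RibbonGraph.nv G) → Div (RibbonGraph.nf G)) → IsDualIso G φ →
    (u : Fin (RibbonGraph.nv G)) (e₀ : Fin (RibbonGraph.n G)) → RibbonGraph.vert G e₀ ≡ u →
    (k : ℕ) → (A : Div (RibbonGraph.nv G)) → Angle G e₀ (iter (σ· G) k e₀) A →
    _~*_ G (φ A) (δ (RibbonGraph.face G e₀) -ᴰ δ (RibbonGraph.face G (iter (σ· G) k e₀)))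
lemma3p2 G _ _ _ _ φ iso u e₀ _ k A (m , (σᵐe₀≡e_k , _) , refl) =
  subst (λ e → _~*_ G (φ (angleSum G e₀ m)) (δ (face e₀) -ᴰ δ (face e)))
        σᵐe₀≡e_k (φ-angleSum φ iso e₀ m)
  where
  open RibbonGraph G
  open Duality G
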